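{- Let $n\ge 3$ be an odd integer. Then (i) for $1\le k\le n-1$: $|E^{ - }_{\rm e}(n,k)|-|E^{ - }_{\rm o}(n,k)| = (n-k)D_{n-1,k-1}$; (ii) for $0\le k\le n-2$: $|E^{+}_{\rm e}(n,k)|-|E^{+}_{\rm o}(n,k)| = (k+1)D_{n-1,k}$.
   Context: Permutations of $[m]=\{1,\dots,m\}$ are written as words $a_1a_2\cdots a_m$. An ascent is an index $i$ ($1\le i\le m-1$) with $a_i<a_{i+1}$. An inversion is a pair $(i,j)$ with $1\le i<j\le m$ and $a_i>a_j$. $E(m,k)$ is the set of permutations of $[m]$ with exactly $k$ ascents; $E_{\rm e}(m,k)$ and $E_{\rm o}(m,k)$ are its subsets of permutations with an even, respectively odd, number of inversions; $D_{m,k}=|E_{\rm e}(m,k)|-|E_{\rm o}(m,k)|$ (signed Eulerian number). $E_{\rm e}^{ - }(n,k)$, $E_{\rm o}^{ - }(n,k)$ denote the permutations $a_1\cdots a_n$ in $E_{\rm e}(n,k)$, respectively $E_{\rm o}(n,k)$, with $a_1<a_n$, and $E_{\rm e}^{+}(n,k)$, $E_{\rm o}^{+}(n,k)$ those with $a_1>a_n$. -}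

module Defs where

open import Data.Nat using (ℕ; zero; suc; _+_; _*_; _∸_; _<ᵇ_; _≡ᵇ_)
open import Data.Bool using (Bool; true; false; not; _∧_; if_then_else_)
open import Data.List using (List; []; _∷_; map; concatMap; filter; length; upTo)
open import Data.Integer as ℤ using (ℤ)
open import Relation.Nullary.Decidable using (Dec; yes; no)
open import Relation.Binary.PropositionalEquality using (_≡_)

words : ℕ → ℕ → List (List ℕ)
words m zero    = [] ∷ []
words m (suc l) = concatMap (λ w → map (λ a → a ∷ w) (map suc (upTo m))) (words m l)

allB : (ℕ → Bool) → List ℕ → Bool
allB p []      = true
allB p (x ∷ w) = p x ∧ allB p w

distinct : List ℕ → Bool
distinct []      = true
distinct (a ∷ w) = allB (λ b → not (a ≡ᵇ b)) w ∧ distinct w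

perms : ℕ → List (List ℕ)
perms m = filter (λ w → Data.Bool._≟_ (distinct w) true) (words m m)

asc : List ℕ → ℕ
asc []           = 0
asc (a ∷ [])     = 0
asc (a ∷ b ∷ w)  = (if a <ᵇ b then 1 else 0) + asc (b ∷ w)

inv : List ℕ → ℕ
inv []      = 0
inv (a ∷ w) = length (filter (λ b → Data.Bool._≟_ (b <ᵇ a) true) w) + inv w

even : ℕ → Bool
even zero          = true
even (suc zero)    = false
even (suc (suc n)) = even n

sgn : List ℕ → ℤ
sgn w = if even (inv w) then ℤ.+ 1 else ℤ.- (ℤ.+ 1)

head0 : List ℕ → ℕ
head0 []      = 0
head0 (a ∷ _) = a

last0 : List ℕ → ℕ
last0 []       = 0
last0 (a ∷ []) = a
last0 (a ∷ w)  = last0 w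

E : ℕ → ℕ → List (List ℕ)
E m k = filter (λ w → asc w Data.Nat.≟ k) (perms m)

-- signed sum Σ_{w ∈ L} (-1)^{inv w} = |even part| − |odd part|
signedCount : List (List ℕ) → ℤ
signedCount []      = ℤ.+ 0
signedCount (w ∷ L) = sgn w ℤ.+ signedCount L

D : ℕ → ℕ → ℤ
D m k = signedCount (E m k)

Eminus : ℕ → ℕ → List (List ℕ)
Eminus n k = filter (λ w → Data.Bool._≟_ (head0 w <ᵇ last0 w) true) (E n k)

Eplus : ℕ → ℕ → List (List ℕ)
Eplus n k = filter (λ w → Data.Bool._≟_ (last0 w <ᵇ head0 w) true) (E n k)

Dminus : ℕ → ℕ → ℤ
Dminus n k = signedCount (Eminus n k)

Dplus : ℕ → ℕ → ℤ
Dplus n k = signedCount (Eplus n k)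

-- Every permutation w of [m + 1] is b ++ (m + 1) ∷ a for exactly one permutation u = a ++ b
-- of [m] and one of its m + 1 cuts (a , b).  The first and last letters of w are the two
-- neighbours of the cut in (m + 1) ∷ u ∷ʳ (m + 1), so w starts higher than it ends at exactly
-- the asc u + 1 cuts that are ascents there, and then asc w = asc u; at the other m − asc u
-- cuts w starts lower and asc w = asc u + 1.  Moreover inv w + inv u ≡ |a| (|b| + 1) (mod 2),
-- which is even when m = |a| + |b| is even, so w and u have the same sign.  Summing over the
-- permutations u of [m] with a given number of ascents gives both identities for n = m + 1.
module Submission where

open import Defs
open import Data.Nat using (ℕ; _≤_; _∸_; _+_; suc)
open import Data.Integer using (ℤ; _*_; +_)
open import Data.Product using (_×_; ∃-syntax)
open import Relation.Binary.PropositionalEquality using (_≡_)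

import Data.Bool
open import Data.Bool using (Bool; true; false; T; not; _∨_; _xor_; if_then_else_)
open import Data.Bool.Properties using (T-≡; T-∧; not-involutive; xor-same; ∨-inverseʳ)
open import Data.Empty using (⊥-elim)
import Data.Integer as ℤ
import Data.Integer.Properties as ℤ
open import Data.List
  using (List; []; _∷_; _++_; _∷ʳ_; map; concatMap; filter; foldr; length; upTo; cartesianProductWith)
open import Data.List.Properties
  using (length-map; length-upTo; length-++; ++-identityʳ; ∷-injective; ∷-injectiveˡ; ∷-injectiveʳ;
         applyUpTo-∷ʳ; map-++; filter-++; filter-all)
open import Data.List.Membership.Propositional using (_∈_; _∉_; find; lose)
open import Data.List.Membership.DecPropositional Data.Nat._≟_ using (_∈?_)
open import Data.List.Membership.Propositional.Properties
  using (∈-map⁺; ∈-map⁻; ∈-++⁺ˡ; ∈-++⁺ʳ; ∈-++⁻; ∈-∃++; ∈-filter⁺; ∈-filter⁻; ∈-upTo⁻;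
         ∈-concatMap⁺; ∈-concatMap⁻; ∈-cartesianProductWith⁺; ∈-cartesianProductWith⁻)
open import Data.List.Membership.Propositional.Properties.WithK using (unique∧set⇒bag)
open import Data.List.Relation.Binary.BagAndSetEquality using (∼bag⇒↭)
open import Data.List.Relation.Binary.Disjoint.Propositional using (Disjoint)
open import Data.List.Relation.Binary.Permutation.Propositional using (_↭_; ↭-sym; ↭-trans; ↭-prep; ↭⇒↭ₛ)
open import Data.List.Relation.Binary.Permutation.Propositional.Properties
  using (map⁺; shift; ++-comm; ↭-length; All-resp-↭; ∈-resp-↭)
import Data.List.Relation.Binary.Permutation.Setoid.Properties as ↭ₛ
open import Data.List.Relation.Unary.All as All using (All; []; _∷_)
import Data.List.Relation.Unary.All.Properties as All
import Data.List.Relation.Unary.AllPairs as AllPairs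
import Data.List.Relation.Unary.AllPairs.Properties as AllPairs
open import Data.List.Relation.Unary.Any using (here; there)
open import Data.List.Relation.Unary.Unique.Propositional using (Unique; []; _∷_)
import Data.List.Relation.Unary.Unique.Propositional.Properties as Unique
import Data.Nat as ℕ
open import Data.Nat using (zero; _<_; _<ᵇ_; _≡ᵇ_; z≤n; s≤s)
open import Data.Nat.Properties
  using (suc-injective; <-irrefl; <-cmp; <⇒≯; <⇒<ᵇ; <ᵇ⇒<; ≡ᵇ⇒≡; ≡⇒≡ᵇ;
         +-identityʳ; +-assoc; +-comm; +-suc; *-suc; m+n∸n≡m)
open import Data.Nat.Tactic.RingSolver using (solve-∀)
open import Data.Product as Product using (_,_; proj₁; proj₂; uncurry)
open import Data.Sum using (inj₁; inj₂)
open import Data.Unit using (tt)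
open import Function using (_∘_; _⇔_; mk⇔; Equivalence)
open import Relation.Binary.Definitions using (tri<; tri≈; tri>)
open import Relation.Binary.PropositionalEquality
  using (_≢_; refl; sym; trans; cong; cong₂; subst; subst₂; setoid; module ≡-Reasoning)
open import Relation.Nullary using (¬_; does; yes; no)
open import Relation.Unary using (Decidable)

private variable
  A B : Set
  j k m n x y : ℕ
  a a′ b b′ u w : List ℕ
  s : ℤ
  xs : List A

∑ : List A → (A → ℤ) → ℤ
∑ xs f = foldr ℤ._+_ ℤ.0ℤ (map f xs)

when : Bool → ℤ → ℤ
when b z = if b then z else ℤ.0ℤ

ind : Bool → ℕ
ind b = if b then 1 else 0

count : (A → Bool) → List A → ℕ
count p []       = 0
count p (x ∷ xs) = ind (p x) + count p xs

∑-cong : (xs : List A) {f g : A → ℤ} → (∀ {x} → x ∈ xs → f x ≡ g x) → ∑ xs f ≡ ∑ xs g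
∑-cong []       f≗g = refl
∑-cong (x ∷ xs) f≗g = cong₂ ℤ._+_ (f≗g (here refl)) (∑-cong xs (f≗g ∘ there))

∑-++ : (xs ys : List A) (f : A → ℤ) → ∑ (xs ++ ys) f ≡ ∑ xs f ℤ.+ ∑ ys f
∑-++ []       ys f = sym (ℤ.+-identityˡ _)
∑-++ (x ∷ xs) ys f = trans (cong (ℤ._+_ (f x)) (∑-++ xs ys f)) (sym (ℤ.+-assoc (f x) _ _))

∑-map : (g : A → B) (xs : List A) (f : B → ℤ) → ∑ (map g xs) f ≡ ∑ xs (f ∘ g)
∑-map g []       f = refl
∑-map g (x ∷ xs) f = cong (ℤ._+_ (f (g x))) (∑-map g xs f)

∑-concatMap : (h : A → List B) (xs : List A) (f : B → ℤ) →
              ∑ (concatMap h xs) f ≡ ∑ xs (λ x → ∑ (h x) f)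
∑-concatMap h []       f = refl
∑-concatMap h (x ∷ xs) f =
  trans (∑-++ (h x) (concatMap h xs) f) (cong (ℤ._+_ (∑ (h x) f)) (∑-concatMap h xs f))

∑-filter : {P : A → Set} (P? : Decidable P) (xs : List A) (f : A → ℤ) →
           ∑ (filter P? xs) f ≡ ∑ xs (λ x → when (does (P? x)) (f x))
∑-filter P? []       f = refl
∑-filter P? (x ∷ xs) f with does (P? x)
... | true  = cong (ℤ._+_ (f x)) (∑-filter P? xs f)
... | false = trans (∑-filter P? xs f) (sym (ℤ.+-identityˡ _))

∑-*ˡ : (c : ℤ) (xs : List A) (f : A → ℤ) → ∑ xs (λ x → c * f x) ≡ c * ∑ xs f
∑-*ˡ c []       f = sym (ℤ.*-zeroʳ c)
∑-*ˡ c (x ∷ xs) f = trans (cong (ℤ._+_ (c * f x)) (∑-*ˡ c xs f)) (sym (ℤ.*-distribˡ-+ c (f x) _))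

∑-when : (p : A → Bool) (c : ℤ) (xs : List A) → ∑ xs (λ x → when (p x) c) ≡ + count p xs * c
∑-when p c []       = refl
∑-when p c (x ∷ xs) with p x
... | true  = trans (cong (ℤ._+_ c) (∑-when p c xs)) (sym (ℤ.suc-* (+ count p xs) c))
... | false = trans (ℤ.+-identityˡ _) (∑-when p c xs)

∑-↭ : {xs ys : List A} (f : A → ℤ) → xs ↭ ys → ∑ xs f ≡ ∑ ys f
∑-↭ f xs↭ys = ↭ₛ.foldr-commMonoid (setoid ℤ) ℤ.+-0-isCommutativeMonoid (↭⇒↭ₛ (map⁺ f xs↭ys))

count-map : (g : A → B) (xs : List A) (p : B → Bool) → count p (map g xs) ≡ count (p ∘ g) xs
count-map g []       p = refl
count-map g (x ∷ xs) p = cong (_+_ (ind (p (g x)))) (count-map g xs p)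

count-not : (p : A → Bool) (xs : List A) → count (not ∘ p) xs + count p xs ≡ length xs
count-not p []       = refl
count-not p (x ∷ xs) with p x
... | true  = trans (+-suc _ _) (cong suc (count-not p xs))
... | false = cong suc (count-not p xs)

when-0 : ∀ b → when b ℤ.0ℤ ≡ ℤ.0ℤ
when-0 true  = refl
when-0 false = refl

*-when-≡ᵇ : ∀ (f : ℕ → ℤ) i j s → f i * when (i ≡ᵇ j) s ≡ f j * when (i ≡ᵇ j) s
*-when-≡ᵇ f i j s with i ≡ᵇ j in eq
... | true  rewrite ≡ᵇ⇒≡ i j (subst T (sym eq) tt) = refl
... | false = trans (ℤ.*-zeroʳ (f i)) (sym (ℤ.*-zeroʳ (f j)))

letters : ℕ → List ℕ
letters m = map suc (upTo m)

record IsPermutation (m : ℕ) (w : List ℕ) : Set where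
  field
    unique  : Unique w
    length≡ : length w ≡ m
    letter  : All (_∈ letters m) w

open IsPermutation

letters-suc : letters (suc m) ≡ letters m ∷ʳ suc m
letters-suc {m} = trans (cong (map suc) (sym (applyUpTo-∷ʳ (λ i → i) m))) (map-++ suc (upTo m) _)

letters-⊆-suc : x ∈ letters m → x ∈ letters (suc m)
letters-⊆-suc x∈ = subst (_ ∈_) (sym letters-suc) (∈-++⁺ˡ x∈)

suc∈letters-suc : suc m ∈ letters (suc m)
suc∈letters-suc {m} = subst (suc m ∈_) (sym letters-suc) (∈-++⁺ʳ (letters m) (here refl))

∈-letters-suc⁻ : x ∈ letters (suc m) → x ≢ suc m → x ∈ letters m
∈-letters-suc⁻ {m = m} x∈ x≢ with ∈-++⁻ (letters m) (subst (_ ∈_) letters-suc x∈)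
... | inj₁ x∈′       = x∈′
... | inj₂ (here x≡) = ⊥-elim (x≢ x≡)

∈-letters⇒≤ : x ∈ letters m → x ≤ m
∈-letters⇒≤ x∈ with ∈-map⁻ suc x∈
... | i , i∈ , refl = ∈-upTo⁻ i∈

Unique-letters : ∀ m → Unique (letters m)
Unique-letters m = Unique.map⁺ suc-injective (Unique.upTo⁺ m)

length-letters : ∀ m → length (letters m) ≡ m
length-letters m = trans (length-map suc (upTo m)) (length-upTo m)

pigeonhole : {ys : List A} → Unique xs → All (_∈ ys) xs → length xs ≤ length ys
pigeonhole [] [] = z≤n
pigeonhole {xs = x ∷ _} (x≢xs ∷ !xs) (x∈ys ∷ xs⊆ys) with ∈-∃++ x∈ys
... | p , q , refl =
  subst (_ ≤_) (sym (↭-length (shift x p q))) (s≤s (pigeonhole !xs (All.zipWith drop (x≢xs , xs⊆ys))))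
  where
  drop : ∀ {z} → x ≢ z × z ∈ p ++ x ∷ q → z ∈ p ++ q
  drop (x≢z , z∈) with ∈-resp-↭ (shift x p q) z∈
  ... | here z≡x  = ⊥-elim (x≢z (sym z≡x))
  ... | there z∈′ = z∈′

IsPermutation⇒< : IsPermutation m u → All (_< suc m) u
IsPermutation⇒< π = All.map (s≤s ∘ ∈-letters⇒≤) (letter π)

IsPermutation-resp-↭ : u ↭ w → IsPermutation m u → IsPermutation m w
IsPermutation-resp-↭ u↭w π = record
  { unique  = ↭ₛ.Unique-resp-↭ (setoid ℕ) (↭⇒↭ₛ u↭w) (unique π)
  ; length≡ = trans (sym (↭-length u↭w)) (length≡ π)
  ; letter  = All-resp-↭ u↭w (letter π)
  }

top∉ : IsPermutation m u → suc m ∉ u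
top∉ π m∈ = <-irrefl refl (All.lookup (IsPermutation⇒< π) m∈)

top∈ : IsPermutation (suc m) w → suc m ∈ w
top∈ {m} {w} π with suc m ∈? w
... | yes m∈ = m∈
... | no  m∉ = ⊥-elim (<-irrefl refl (subst₂ _≤_ (length≡ π) (length-letters m) (pigeonhole (unique π) w⊆)))
  where
  w⊆ : All (_∈ letters m) w
  w⊆ = All.tabulate λ z∈ → ∈-letters-suc⁻ (All.lookup (letter π) z∈) (λ z≡ → m∉ (subst (_∈ w) z≡ z∈))

IsPermutation-top∷⁺ : IsPermutation m u → IsPermutation (suc m) (suc m ∷ u)
IsPermutation-top∷⁺ {u = u} π = record
  { unique  = All.tabulate (λ z∈ m≡z → top∉ π (subst (_∈ u) (sym m≡z) z∈)) ∷ unique π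
  ; length≡ = cong suc (length≡ π)
  ; letter  = suc∈letters-suc ∷ All.map letters-⊆-suc (letter π)
  }

IsPermutation-top∷⁻ : IsPermutation (suc m) (suc m ∷ u) → IsPermutation m u
IsPermutation-top∷⁻ π with unique π | letter π
... | m≢u ∷ !u | _ ∷ u⊆ = record
  { unique  = !u
  ; length≡ = suc-injective (length≡ π)
  ; letter  = All.zipWith (λ (m≢z , z∈) → ∈-letters-suc⁻ z∈ (m≢z ∘ sym)) (m≢u , u⊆)
  }

concatMap-map≡cartesianProductWith : ∀ {C : Set} (f : A → B → C) (xs : List A) (ys : List B) →
                                     concatMap (λ x → map (f x) ys) xs ≡ cartesianProductWith f xs ys
concatMap-map≡cartesianProductWith f []       ys = refl
concatMap-map≡cartesianProductWith f (x ∷ xs) ys =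
  cong (map (f x) ys ++_) (concatMap-map≡cartesianProductWith f xs ys)

words-suc : ∀ m l → words m (suc l) ≡ cartesianProductWith (λ w a → a ∷ w) (words m l) (letters m)
words-suc m l = concatMap-map≡cartesianProductWith (λ w a → a ∷ w) (words m l) (letters m)

∈-words⁻ : ∀ l → w ∈ words m l → length w ≡ l × All (_∈ letters m) w
∈-words⁻ zero    (here refl) = refl , []
∈-words⁻ {m = m} (suc l) w∈ with ∈-cartesianProductWith⁻ (λ w a → a ∷ w) (words m l) (letters m)
                                    (subst (_ ∈_) (words-suc m l) w∈)
... | v , a , v∈ , a∈ , refl = Product.map (cong suc) (a∈ ∷_) (∈-words⁻ l v∈)

∈-words⁺ : All (_∈ letters m) w → w ∈ words m (length w)
∈-words⁺ []                        = here refl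
∈-words⁺ {m} {a ∷ w} (a∈ ∷ w⊆) = subst (a ∷ w ∈_) (sym (words-suc m (length w)))
  (∈-cartesianProductWith⁺ (λ w a → a ∷ w) (∈-words⁺ w⊆) a∈)

Unique-words : ∀ m l → Unique (words m l)
Unique-words m zero    = [] ∷ []
Unique-words m (suc l) = subst Unique (sym (words-suc m l))
  (Unique.cartesianProductWith⁺ (λ w a → a ∷ w) (Product.swap ∘ ∷-injective)
                                 (Unique-words m l) (Unique-letters m))

T-not-≡ᵇ : T (not (x ≡ᵇ y)) ⇔ x ≢ y
T-not-≡ᵇ {x} {y} with x ≡ᵇ y in eq
... | true  = mk⇔ (λ ()) (λ x≢y → x≢y (≡ᵇ⇒≡ x y (subst T (sym eq) tt)))
... | false = mk⇔ (λ _ x≡y → subst T eq (≡⇒≡ᵇ x y x≡y)) (λ _ → tt)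

T-allB : (p : ℕ → Bool) (w : List ℕ) → T (allB p w) ⇔ All (T ∘ p) w
T-allB p []      = mk⇔ (λ _ → []) (λ _ → tt)
T-allB p (x ∷ w) = mk⇔
  (λ t → let px , pw = Equivalence.to T-∧ t in px ∷ Equivalence.to (T-allB p w) pw)
  (λ { (px ∷ pw) → Equivalence.from T-∧ (px , Equivalence.from (T-allB p w) pw) })

T-distinct : (w : List ℕ) → T (distinct w) ⇔ Unique w
T-distinct []      = mk⇔ (λ _ → []) (λ _ → tt)
T-distinct (x ∷ w) = mk⇔
  (λ t → let fresh , rest = Equivalence.to T-∧ t in
         All.map (Equivalence.to T-not-≡ᵇ) (Equivalence.to (T-allB _ w) fresh)
         ∷ Equivalence.to (T-distinct w) rest)
  (λ { (x≢w ∷ !w) → Equivalence.from T-∧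
         ( Equivalence.from (T-allB _ w) (All.map (Equivalence.from T-not-≡ᵇ) x≢w)
         , Equivalence.from (T-distinct w) !w) })

∈-perms⁻ : w ∈ perms m → IsPermutation m w
∈-perms⁻ {w} w∈ with ∈-filter⁻ (λ w → Data.Bool._≟_ (distinct w) true) w∈
... | w∈words , d with ∈-words⁻ _ w∈words
... | len , w⊆ = record
  { unique = Equivalence.to (T-distinct w) (Equivalence.from T-≡ d) ; length≡ = len ; letter = w⊆ }

∈-perms⁺ : IsPermutation m w → w ∈ perms m
∈-perms⁺ {w = w} π = ∈-filter⁺ (λ w → Data.Bool._≟_ (distinct w) true)
  (subst (λ l → w ∈ words _ l) (length≡ π) (∈-words⁺ (letter π)))
  (Equivalence.to T-≡ (Equivalence.from (T-distinct w) (unique π)))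

Unique-perms : ∀ m → Unique (perms m)
Unique-perms m = Unique.filter⁺ _ (Unique-words m m)

-- Cutting a permutation and inserting the top letter

splits : List A → List (List A × List A)
splits []       = ([] , []) ∷ []
splits (x ∷ xs) = ([] , x ∷ xs) ∷ map (Product.map₁ (x ∷_)) (splits xs)

splits-sound : (xs : List A) {p : List A × List A} → p ∈ splits xs → uncurry _++_ p ≡ xs
splits-sound []       (here refl) = refl
splits-sound (x ∷ xs) (here refl) = refl
splits-sound (x ∷ xs) (there p∈) with ∈-map⁻ (Product.map₁ (x ∷_)) p∈
... | q , q∈ , refl = cong (x ∷_) (splits-sound xs q∈)

splits-complete : (ys zs : List A) → (ys , zs) ∈ splits (ys ++ zs)
splits-complete []       []      = here refl
splits-complete []       (_ ∷ _) = here refl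
splits-complete (y ∷ ys) zs      = there (∈-map⁺ (Product.map₁ (y ∷_)) (splits-complete ys zs))

length-splits : (xs : List A) → length (splits xs) ≡ suc (length xs)
length-splits []       = refl
length-splits (x ∷ xs) = cong suc (trans (length-map _ (splits xs)) (length-splits xs))

Unique-splits : (xs : List A) → Unique (splits xs)
Unique-splits []       = [] ∷ []
Unique-splits (x ∷ xs) =
  All.tabulate (λ p∈ []≡p → nonempty p∈ (cong proj₁ (sym []≡p)))
  ∷ Unique.map⁺ map₁-injective (Unique-splits xs)
  where
  nonempty : ∀ {p} → p ∈ map (Product.map₁ (x ∷_)) (splits xs) → proj₁ p ≢ []
  nonempty p∈ with ∈-map⁻ (Product.map₁ (x ∷_)) p∈
  ... | _ , _ , refl = λ ()
  map₁-injective : ∀ {p q} → Product.map₁ (x ∷_) p ≡ Product.map₁ (x ∷_) q → p ≡ q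
  map₁-injective eq = cong₂ _,_ (∷-injectiveʳ (cong proj₁ eq)) (cong proj₂ eq)

splits-disjoint : {xs ys : List A} → xs ≢ ys → Disjoint (splits xs) (splits ys)
splits-disjoint {xs = xs} {ys} xs≢ys (p∈xs , p∈ys) =
  xs≢ys (trans (sym (splits-sound xs p∈xs)) (splits-sound ys p∈ys))

Unique-concatMap-splits : {xss : List (List A)} → Unique xss → Unique (concatMap splits xss)
Unique-concatMap-splits !xss =
  Unique.concat⁺ (All.map⁺ (All.universal Unique-splits _))
                 (AllPairs.map⁺ (AllPairs.map splits-disjoint !xss))

Unique-map⁺-on : {f : A → B} → (∀ {x y} → x ∈ xs → y ∈ xs → f x ≡ f y → x ≡ y) →
                 Unique xs → Unique (map f xs)
Unique-map⁺-on inj []           = []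
Unique-map⁺-on inj (x≢xs ∷ !xs) =
  All.map⁺ (All.tabulate (λ y∈ fx≡fy → All.lookup x≢xs y∈ (inj (here refl) (there y∈) fx≡fy)))
  ∷ Unique-map⁺-on (λ x∈ y∈ → inj (there x∈) (there y∈)) !xs

rotate : ℕ → List ℕ × List ℕ → List ℕ
rotate n (a , b) = b ++ n ∷ a

rotate-↭ : ∀ n a b → rotate n (a , b) ↭ n ∷ a ++ b
rotate-↭ n a b = ↭-trans (shift n b a) (↭-prep n (++-comm b a))

rotate-injective : n ∉ b → n ∉ b′ → rotate n (a , b) ≡ rotate n (a′ , b′) → (a , b) ≡ (a′ , b′)
rotate-injective {b = []}    {b′ = []}    _  _   eq = cong (_, []) (∷-injectiveʳ eq)
rotate-injective {b = []}    {b′ = _ ∷ _} _  n∉′ eq = ⊥-elim (n∉′ (here (∷-injectiveˡ eq)))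
rotate-injective {b = _ ∷ _} {b′ = []}    n∉ _   eq = ⊥-elim (n∉ (here (sym (∷-injectiveˡ eq))))
rotate-injective {b = _ ∷ _} {b′ = _ ∷ _} n∉ n∉′ eq with ∷-injective eq
... | refl , eq′ with rotate-injective (n∉ ∘ there) (n∉′ ∘ there) eq′
... | refl = refl

rotations : ℕ → List (List ℕ)
rotations m = map (rotate (suc m)) (concatMap splits (perms m))

∈-concatMap-splits⁻ : ∀ {p} → p ∈ concatMap splits (perms m) → IsPermutation m (uncurry _++_ p)
∈-concatMap-splits⁻ p∈ with find (∈-concatMap⁻ splits p∈)
... | u , u∈ , p∈u = subst (IsPermutation _) (sym (splits-sound u p∈u)) (∈-perms⁻ u∈)

∈-rotations⁻ : w ∈ rotations m → IsPermutation (suc m) w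
∈-rotations⁻ w∈ with ∈-map⁻ (rotate _) w∈
... | (a , b) , p∈ , refl =
  IsPermutation-resp-↭ (↭-sym (rotate-↭ _ a b)) (IsPermutation-top∷⁺ (∈-concatMap-splits⁻ p∈))

∈-rotations⁺ : IsPermutation (suc m) w → w ∈ rotations m
∈-rotations⁺ {m} π with ∈-∃++ (top∈ π)
... | b , a , refl = ∈-map⁺ (rotate (suc m)) (∈-concatMap⁺ splits (lose u∈ (splits-complete a b)))
  where
  u∈ : a ++ b ∈ perms m
  u∈ = ∈-perms⁺ (IsPermutation-top∷⁻ (IsPermutation-resp-↭ (rotate-↭ (suc m) a b) π))

Unique-rotations : ∀ m → Unique (rotations m)
Unique-rotations m = Unique-map⁺-on injective (Unique-concatMap-splits (Unique-perms m))
  where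
  top∉-right : ∀ {p} → p ∈ concatMap splits (perms m) → suc m ∉ proj₂ p
  top∉-right {a , b} p∈ = top∉ (∈-concatMap-splits⁻ p∈) ∘ ∈-++⁺ʳ a
  injective : ∀ {p q} → p ∈ concatMap splits (perms m) → q ∈ concatMap splits (perms m) →
              rotate (suc m) p ≡ rotate (suc m) q → p ≡ q
  injective {_ , _} {_ , _} p∈ q∈ = rotate-injective (top∉-right p∈) (top∉-right q∈)

perms-suc-↭ : ∀ m → perms (suc m) ↭ rotations m
perms-suc-↭ m = ∼bag⇒↭ (unique∧set⇒bag (Unique-perms (suc m)) (Unique-rotations m)
  (mk⇔ (∈-rotations⁺ ∘ ∈-perms⁻) (∈-perms⁺ ∘ ∈-rotations⁻)))

∑-perms-suc : ∀ m (F : List ℕ → ℤ) →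
              ∑ (perms (suc m)) F ≡ ∑ (perms m) (λ u → ∑ (splits u) (F ∘ rotate (suc m)))
∑-perms-suc m F = begin
  ∑ (perms (suc m)) F
    ≡⟨ ∑-↭ F (perms-suc-↭ m) ⟩
  ∑ (rotations m) F
    ≡⟨ ∑-map (rotate (suc m)) (concatMap splits (perms m)) F ⟩
  ∑ (concatMap splits (perms m)) (F ∘ rotate (suc m))
    ≡⟨ ∑-concatMap splits (perms m) _ ⟩
  ∑ (perms m) (λ u → ∑ (splits u) (F ∘ rotate (suc m))) ∎
  where open ≡-Reasoning

<ᵇ-true : x < y → (x <ᵇ y) ≡ true
<ᵇ-true = Equivalence.to T-≡ ∘ <⇒<ᵇ

<ᵇ-false : ¬ x < y → (x <ᵇ y) ≡ false
<ᵇ-false {x} {y} x≮y with x <ᵇ y in eq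
... | true  = ⊥-elim (x≮y (<ᵇ⇒< x y (subst T (sym eq) tt)))
... | false = refl

<ᵇ-flip : x ≢ y → (x <ᵇ y) ≡ not (y <ᵇ x)
<ᵇ-flip {x} {y} x≢y with <-cmp x y
... | tri< x<y _ y≮x = trans (<ᵇ-true x<y) (sym (cong not (<ᵇ-false y≮x)))
... | tri≈ _ x≡y _   = ⊥-elim (x≢y x≡y)
... | tri> x≮y _ y<x = trans (<ᵇ-false x≮y) (sym (cong not (<ᵇ-true y<x)))

last0-∈ : ∀ x xs → last0 (x ∷ xs) ∈ x ∷ xs
last0-∈ x []       = here refl
last0-∈ x (y ∷ xs) = there (last0-∈ y xs)

last0-++-∷ : ∀ xs y ys → last0 (xs ++ y ∷ ys) ≡ last0 (y ∷ ys)
last0-++-∷ []           y ys = refl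
last0-++-∷ (x ∷ [])     y ys = refl
last0-++-∷ (x ∷ z ∷ xs) y ys = last0-++-∷ (z ∷ xs) y ys

head0≢last0 : Unique w → 2 ≤ length w → head0 w ≢ last0 w
head0≢last0 {x ∷ []}    _        (s≤s ())
head0≢last0 {x ∷ y ∷ w} (x≢ ∷ _) _ = All.lookup x≢ (last0-∈ y w)

head0-rotate : ∀ n a b → head0 (rotate n (a , b)) ≡ head0 (b ∷ʳ n)
head0-rotate n a []      = refl
head0-rotate n a (_ ∷ _) = refl

last0-rotate : ∀ n a b → last0 (rotate n (a , b)) ≡ last0 (n ∷ a)
last0-rotate n a b = last0-++-∷ b n a

asc-++-∷ : ∀ xs y ys → asc (xs ++ y ∷ ys) ≡ asc (xs ∷ʳ y) + asc (y ∷ ys)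
asc-++-∷ []           y ys = refl
asc-++-∷ (x ∷ [])     y ys = cong (_+ asc (y ∷ ys)) (sym (+-identityʳ _))
asc-++-∷ (x ∷ z ∷ xs) y ys =
  trans (cong (_+_ (ind (x <ᵇ z))) (asc-++-∷ (z ∷ xs) y ys)) (sym (+-assoc (ind (x <ᵇ z)) _ _))

asc-∷ʳ : ∀ x xs y → asc ((x ∷ xs) ∷ʳ y) ≡ asc (x ∷ xs) + ind (last0 (x ∷ xs) <ᵇ y)
asc-∷ʳ x []       y = +-identityʳ _
asc-∷ʳ x (z ∷ xs) y =
  trans (cong (_+_ (ind (x <ᵇ z))) (asc-∷ʳ z xs y)) (sym (+-assoc (ind (x <ᵇ z)) _ _))

asc-∷ʳ-max : All (_< n) (x ∷ u) → asc ((x ∷ u) ∷ʳ n) ≡ suc (asc (x ∷ u))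
asc-∷ʳ-max {n} {x} {u} x∷u<n = begin
  asc ((x ∷ u) ∷ʳ n)
    ≡⟨ asc-∷ʳ x u n ⟩
  asc (x ∷ u) + ind (last0 (x ∷ u) <ᵇ n)
    ≡⟨ cong (λ c → asc (x ∷ u) + ind c) (<ᵇ-true (All.lookup x∷u<n (last0-∈ x u))) ⟩
  asc (x ∷ u) + 1
    ≡⟨ +-comm _ 1 ⟩
  suc (asc (x ∷ u)) ∎
  where open ≡-Reasoning

asc-max-∷ : ∀ u → x < n → asc (n ∷ x ∷ u) ≡ asc (x ∷ u)
asc-max-∷ {x} u x<n = cong (λ c → ind c + asc (x ∷ u)) (<ᵇ-false (<⇒≯ x<n))

-- The indicator sits on the left so that no hypothesis head ≢ last is needed.
asc-rotate : ∀ n a b → All (_< n) (a ++ b) → a ++ b ≢ [] →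
             asc (rotate n (a , b)) + ind (last0 (n ∷ a) <ᵇ head0 (b ∷ʳ n)) ≡ suc (asc (a ++ b))
asc-rotate n []      []      _ []≢[] = ⊥-elim ([]≢[] refl)
asc-rotate n []      (y ∷ b) b<n _   = begin
  asc ((y ∷ b) ∷ʳ n) + ind (n <ᵇ y)
    ≡⟨ cong (λ c → asc ((y ∷ b) ∷ʳ n) + ind c) (<ᵇ-false (<⇒≯ (All.lookup b<n (here refl)))) ⟩
  asc ((y ∷ b) ∷ʳ n) + 0             ≡⟨ +-identityʳ _ ⟩
  asc ((y ∷ b) ∷ʳ n)                 ≡⟨ asc-∷ʳ-max b<n ⟩
  suc (asc (y ∷ b))                  ∎
  where open ≡-Reasoning
asc-rotate n (x ∷ a) []      a<n _ rewrite ++-identityʳ (x ∷ a) = begin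
  asc (n ∷ x ∷ a) + ind (last0 (x ∷ a) <ᵇ n)
    ≡⟨ cong₂ (λ k c → k + ind c) (asc-max-∷ a (All.lookup a<n (here refl)))
                                  (<ᵇ-true (All.lookup a<n (last0-∈ x a))) ⟩
  asc (x ∷ a) + 1                             ≡⟨ +-comm _ 1 ⟩
  suc (asc (x ∷ a))                           ∎
  where open ≡-Reasoning
asc-rotate n (x ∷ a) (y ∷ b) ab<n _ = begin
  asc ((y ∷ b) ++ n ∷ x ∷ a) + i
    ≡⟨ cong (_+ i) (asc-++-∷ (y ∷ b) n (x ∷ a)) ⟩
  (asc ((y ∷ b) ∷ʳ n) + asc (n ∷ x ∷ a)) + i
    ≡⟨ cong₂ (λ k l → (k + l) + i) (asc-∷ʳ-max b<n) (asc-max-∷ a (All.lookup a<n (here refl))) ⟩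
  (suc (asc (y ∷ b)) + asc (x ∷ a)) + i
    ≡⟨ rearrange (asc (x ∷ a)) (asc (y ∷ b)) i ⟩
  suc ((asc (x ∷ a) + i) + asc (y ∷ b))
    ≡⟨ cong (λ k → suc (k + asc (y ∷ b))) (asc-∷ʳ x a y) ⟨
  suc (asc ((x ∷ a) ∷ʳ y) + asc (y ∷ b))
    ≡⟨ cong suc (asc-++-∷ (x ∷ a) y b) ⟨
  suc (asc ((x ∷ a) ++ y ∷ b)) ∎
  where
  open ≡-Reasoning
  i : ℕ
  i = ind (last0 (x ∷ a) <ᵇ y)
  a<n : All (_< n) (x ∷ a)
  a<n = All.++⁻ˡ (x ∷ a) ab<n
  b<n : All (_< n) (y ∷ b)
  b<n = All.++⁻ʳ (x ∷ a) ab<n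
  rearrange : ∀ p q r → (suc q + p) + r ≡ suc ((p + r) + q)
  rearrange = solve-∀

ascendingCut : ℕ → ℕ → List ℕ × List ℕ → Bool
ascendingCut x c p = last0 (x ∷ proj₁ p) <ᵇ head0 (proj₂ p ∷ʳ c)

count-ascendingCut : ∀ x c u → count (ascendingCut x c) (splits u) ≡ asc (x ∷ u ∷ʳ c)
count-ascendingCut x c []      = refl
count-ascendingCut x c (y ∷ u) =
  cong (_+_ (ind (x <ᵇ y))) (trans (count-map _ (splits u) (ascendingCut x c)) (count-ascendingCut y c u))

count-ascendingCut-max : All (_< n) (x ∷ u) →
                         count (ascendingCut n n) (splits (x ∷ u)) ≡ suc (asc (x ∷ u))
count-ascendingCut-max {n} {x} {u} x∷u<n = trans (count-ascendingCut n n (x ∷ u))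
  (trans (asc-max-∷ (u ∷ʳ n) (All.lookup x∷u<n (here refl))) (asc-∷ʳ-max x∷u<n))

-- Inversions and sign of a rotation

-- Matches the summand of inv, so inv (x ∷ ys) ≡ smaller x ys + inv ys holds by definition.
smaller : ℕ → List ℕ → ℕ
smaller x ys = length (filter (λ y → Data.Bool._≟_ (y <ᵇ x) true) ys)

greater : ℕ → List ℕ → ℕ
greater x ys = length (filter (λ y → Data.Bool._≟_ (x <ᵇ y) true) ys)

cross : List ℕ → List ℕ → ℕ
cross []       ys = 0
cross (x ∷ xs) ys = smaller x ys + cross xs ys

smaller-∷ : ∀ x y ys → smaller x (y ∷ ys) ≡ ind (y <ᵇ x) + smaller x ys
smaller-∷ x y ys with y <ᵇ x
... | true  = refl
... | false = refl

greater-∷ : ∀ x y ys → greater x (y ∷ ys) ≡ ind (x <ᵇ y) + greater x ys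
greater-∷ x y ys with x <ᵇ y
... | true  = refl
... | false = refl

smaller-++ : ∀ x xs ys → smaller x (xs ++ ys) ≡ smaller x xs + smaller x ys
smaller-++ x xs ys = trans (cong length (filter-++ _ xs ys)) (length-++ (filter _ xs))

smaller-max : All (_< n) a → smaller n a ≡ length a
smaller-max a<n = cong length (filter-all _ (All.map <ᵇ-true a<n))

ind-flip : x ≢ y → ind (x <ᵇ y) + ind (y <ᵇ x) ≡ 1
ind-flip {x} {y} x≢y rewrite <ᵇ-flip x≢y with y <ᵇ x
... | true  = refl
... | false = refl

interchange : ∀ p q r s → (p + q) + (r + s) ≡ (p + r) + (q + s)
interchange = solve-∀

smaller+greater : ∀ ys → All (x ≢_) ys → smaller x ys + greater x ys ≡ length ys
smaller+greater     []       []            = refl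
smaller+greater {x} (y ∷ ys) (x≢y ∷ x≢ys) = begin
  smaller x (y ∷ ys) + greater x (y ∷ ys)
    ≡⟨ cong₂ _+_ (smaller-∷ x y ys) (greater-∷ x y ys) ⟩
  (ind (y <ᵇ x) + smaller x ys) + (ind (x <ᵇ y) + greater x ys)
    ≡⟨ interchange (ind (y <ᵇ x)) _ (ind (x <ᵇ y)) _ ⟩
  (ind (y <ᵇ x) + ind (x <ᵇ y)) + (smaller x ys + greater x ys)
    ≡⟨ cong₂ _+_ (ind-flip (x≢y ∘ sym)) (smaller+greater ys x≢ys) ⟩
  suc (length ys) ∎
  where open ≡-Reasoning

inv-++ : ∀ xs ys → inv (xs ++ ys) ≡ inv xs + inv ys + cross xs ys
inv-++ []       ys = sym (+-identityʳ (inv ys))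
inv-++ (x ∷ xs) ys = begin
  smaller x (xs ++ ys) + inv (xs ++ ys)
    ≡⟨ cong₂ _+_ (smaller-++ x xs ys) (inv-++ xs ys) ⟩
  (smaller x xs + smaller x ys) + (inv xs + inv ys + cross xs ys)
    ≡⟨ rearrange (smaller x xs) (smaller x ys) (inv xs) (inv ys) _ ⟩
  (smaller x xs + inv xs) + inv ys + (smaller x ys + cross xs ys) ∎
  where
  open ≡-Reasoning
  rearrange : ∀ p q r s t → (p + q) + (r + s + t) ≡ (p + r) + s + (q + t)
  rearrange = solve-∀

cross-[] : ∀ xs → cross xs [] ≡ 0
cross-[] []       = refl
cross-[] (x ∷ xs) = cross-[] xs

cross-∷ : ∀ x xs ys → cross ys (x ∷ xs) ≡ greater x ys + cross ys xs
cross-∷ x xs []       = refl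
cross-∷ x xs (y ∷ ys) = begin
  smaller y (x ∷ xs) + cross ys (x ∷ xs)
    ≡⟨ cong₂ _+_ (smaller-∷ y x xs) (cross-∷ x xs ys) ⟩
  (ind (x <ᵇ y) + smaller y xs) + (greater x ys + cross ys xs)
    ≡⟨ interchange (ind (x <ᵇ y)) _ (greater x ys) _ ⟩
  (ind (x <ᵇ y) + greater x ys) + (smaller y xs + cross ys xs)
    ≡⟨ cong (_+ (smaller y xs + cross ys xs)) (greater-∷ x y ys) ⟨
  greater x (y ∷ ys) + cross (y ∷ ys) xs ∎
  where open ≡-Reasoning

cross-max : All (_< n) b → cross b (n ∷ a) ≡ cross b a
cross-max                 []          = refl
cross-max {n} {y ∷ b} {a} (y<n ∷ b<n) =
  cong₂ _+_ (trans (smaller-∷ y n a) (cong (λ c → ind c + smaller y a) (<ᵇ-false (<⇒≯ y<n))))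
            (cross-max b<n)

cross+cross : ∀ a b → Unique (a ++ b) → cross a b + cross b a ≡ length a ℕ.* length b
cross+cross []      b _            = cross-[] b
cross+cross (x ∷ a) b (x≢ab ∷ !ab) = begin
  (smaller x b + cross a b) + cross b (x ∷ a)
    ≡⟨ cong (_+_ (smaller x b + cross a b)) (cross-∷ x a b) ⟩
  (smaller x b + cross a b) + (greater x b + cross b a)
    ≡⟨ interchange (smaller x b) _ (greater x b) _ ⟩
  (smaller x b + greater x b) + (cross a b + cross b a)
    ≡⟨ cong₂ _+_ (smaller+greater b (All.++⁻ʳ a x≢ab)) (cross+cross a b !ab) ⟩
  length b + length a ℕ.* length b ∎
  where open ≡-Reasoning

inv-rotate : ∀ n a b → All (_< n) (a ++ b) → Unique (a ++ b) →
             inv (rotate n (a , b)) + inv (a ++ b)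
               ≡ (inv a + inv b) + (inv a + inv b) + length a ℕ.* suc (length b)
inv-rotate n a b ab<n !ab = begin
  inv (b ++ n ∷ a) + inv (a ++ b)
    ≡⟨ cong₂ _+_ (inv-++ b (n ∷ a)) (inv-++ a b) ⟩
  (inv b + (smaller n a + inv a) + cross b (n ∷ a)) + (inv a + inv b + cross a b)
    ≡⟨ cong₂ (λ k l → (inv b + (k + inv a) + l) + (inv a + inv b + cross a b))
             (smaller-max (All.++⁻ˡ a ab<n)) (cross-max (All.++⁻ʳ a ab<n)) ⟩
  (inv b + (length a + inv a) + cross b a) + (inv a + inv b + cross a b)
    ≡⟨ rearrange (inv a) (inv b) (length a) (cross a b) (cross b a) ⟩
  X + X + (length a + (cross a b + cross b a))
    ≡⟨ cong (λ k → X + X + (length a + k)) (cross+cross a b !ab) ⟩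
  X + X + (length a + length a ℕ.* length b)
    ≡⟨ cong (_+_ (X + X)) (*-suc (length a) (length b)) ⟨
  X + X + length a ℕ.* suc (length b)
    ∎
  where
  open ≡-Reasoning
  X : ℕ
  X = inv a + inv b
  rearrange : ∀ p q l r s → (q + (l + p) + s) + (p + q + r) ≡ (p + q) + (p + q) + (l + (r + s))
  rearrange = solve-∀

even-suc : ∀ k → even (suc k) ≡ not (even k)
even-suc zero    = refl
even-suc (suc k) = trans (sym (not-involutive (even k))) (cong not (sym (even-suc k)))

even-+ : ∀ k l → even (k + l) ≡ not (even k xor even l)
even-+ zero    l = sym (not-involutive (even l))
even-+ (suc k) l rewrite even-suc (k + l) | even-suc k | even-+ k l with even k | even l
... | true  | true  = refl
... | true  | false = refl
... | false | true  = refl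
... | false | false = refl

even-* : ∀ k l → even (k ℕ.* l) ≡ even k ∨ even l
even-* zero    l = refl
even-* (suc k) l rewrite even-+ l (k ℕ.* l) | even-* k l | even-suc k with even k | even l
... | true  | true  = refl
... | true  | false = refl
... | false | true  = refl
... | false | false = refl

even-double : ∀ k → even (k + k) ≡ true
even-double k = trans (even-+ k k) (cong not (xor-same (even k)))

even-+⁺ : ∀ k l → even k ≡ even l → even (k + l) ≡ true
even-+⁺ k l e = trans (even-+ k l) (cong not (trans (cong (_xor even l) e) (xor-same (even l))))

even-+⁻ : ∀ k l → even (k + l) ≡ true → even k ≡ even l
even-+⁻ k l e with even k | even l | trans (sym (even-+ k l)) e
... | true  | true  | _ = refl
... | false | false | _ = refl

even-*-suc : ∀ k l → even k ≡ even l → even (k ℕ.* suc l) ≡ true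
even-*-suc k l e = begin
  even (k ℕ.* suc l)     ≡⟨ even-* k (suc l) ⟩
  even k ∨ even (suc l)  ≡⟨ cong₂ _∨_ e (even-suc l) ⟩
  even l ∨ not (even l)  ≡⟨ ∨-inverseʳ (even l) ⟩
  true                   ∎
  where open ≡-Reasoning

even-inv-rotate : ∀ n a b → All (_< n) (a ++ b) → Unique (a ++ b) → even (length (a ++ b)) ≡ true →
                  even (inv (rotate n (a , b))) ≡ even (inv (a ++ b))
even-inv-rotate n a b ab<n !ab even-ab = even-+⁻ (inv (rotate n (a , b))) (inv (a ++ b)) (begin
  even (inv (rotate n (a , b)) + inv (a ++ b))  ≡⟨ cong even (inv-rotate n a b ab<n !ab) ⟩
  even (X + X + length a ℕ.* suc (length b))    ≡⟨ even-+⁺ (X + X) _ (trans (even-double X) (sym even-Y)) ⟩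
  true                                          ∎)
  where
  open ≡-Reasoning
  X : ℕ
  X = inv a + inv b
  even-Y : even (length a ℕ.* suc (length b)) ≡ true
  even-Y = even-*-suc (length a) (length b)
             (even-+⁻ (length a) (length b) (trans (cong even (sym (length-++ a))) even-ab))

sgn-rotate : ∀ n a b → All (_< n) (a ++ b) → Unique (a ++ b) → even (length (a ++ b)) ≡ true →
             sgn (rotate n (a , b)) ≡ sgn (a ++ b)
sgn-rotate n a b ab<n !ab even-ab =
  cong (λ e → if e then + 1 else ℤ.- + 1) (even-inv-rotate n a b ab<n !ab even-ab)

signedCount≡∑ : ∀ L → signedCount L ≡ ∑ L sgn
signedCount≡∑ []      = refl
signedCount≡∑ (w ∷ L) = cong (ℤ._+_ (sgn w)) (signedCount≡∑ L)

ascTerm : ℕ → List ℕ → ℤ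
ascTerm j u = when (asc u ≡ᵇ j) (sgn u)

minusTerm : ℕ → List ℕ → ℤ
minusTerm k w = when (asc w ≡ᵇ k) (when (head0 w <ᵇ last0 w) (sgn w))

plusTerm : ℕ → List ℕ → ℤ
plusTerm k w = when (asc w ≡ᵇ k) (when (last0 w <ᵇ head0 w) (sgn w))

does-≟-true : ∀ b → does (Data.Bool._≟_ b true) ≡ b
does-≟-true true  = refl
does-≟-true false = refl

D≡∑ : ∀ m j → D m j ≡ ∑ (perms m) (ascTerm j)
D≡∑ m j = trans (signedCount≡∑ (E m j)) (∑-filter (λ w → asc w ℕ.≟ j) (perms m) sgn)

Dminus≡∑ : ∀ n k → Dminus n k ≡ ∑ (perms n) (minusTerm k)
Dminus≡∑ n k = begin
  Dminus n k
    ≡⟨ signedCount≡∑ (Eminus n k) ⟩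
  ∑ (Eminus n k) sgn
    ≡⟨ trans (∑-filter _ (E n k) sgn) (∑-filter _ (perms n) _) ⟩
  ∑ (perms n) (λ w → when (asc w ≡ᵇ k) (when (does (Data.Bool._≟_ (head0 w <ᵇ last0 w) true)) (sgn w)))
    ≡⟨ ∑-cong (perms n) (λ {w} _ → cong (λ c → when (asc w ≡ᵇ k) (when c (sgn w)))
                                        (does-≟-true (head0 w <ᵇ last0 w))) ⟩
  ∑ (perms n) (minusTerm k) ∎
  where open ≡-Reasoning

Dplus≡∑ : ∀ n k → Dplus n k ≡ ∑ (perms n) (plusTerm k)
Dplus≡∑ n k = begin
  Dplus n k
    ≡⟨ signedCount≡∑ (Eplus n k) ⟩
  ∑ (Eplus n k) sgn
    ≡⟨ trans (∑-filter _ (E n k) sgn) (∑-filter _ (perms n) _) ⟩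
  ∑ (perms n) (λ w → when (asc w ≡ᵇ k) (when (does (Data.Bool._≟_ (last0 w <ᵇ head0 w) true)) (sgn w)))
    ≡⟨ ∑-cong (perms n) (λ {w} _ → cong (λ c → when (asc w ≡ᵇ k) (when c (sgn w)))
                                        (does-≟-true (last0 w <ᵇ head0 w))) ⟩
  ∑ (perms n) (plusTerm k) ∎
  where open ≡-Reasoning

when-minus : ∀ {k l} c → k + ind c ≡ suc l →
             when (k ≡ᵇ suc j) (when (not c) s) ≡ when (not c) (when (l ≡ᵇ j) s)
when-minus {j} {k = k} true  _ = when-0 (k ≡ᵇ suc j)
when-minus             false e rewrite trans (sym (+-identityʳ _)) e = refl

when-plus : ∀ {k l} c → k + ind c ≡ suc l →
            when (k ≡ᵇ j) (when c s) ≡ when c (when (l ≡ᵇ j) s)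
when-plus     {k = k} true  e rewrite suc-injective (trans (+-comm 1 k) e) = refl
when-plus {j} {k = k} false _ = when-0 (k ≡ᵇ j)

module _ {m : ℕ} (0<m : 0 < m) (m-even : even m ≡ true) where

  private
    cut : List ℕ × List ℕ → Bool
    cut = ascendingCut (suc m) (suc m)

  module _ (a b : List ℕ) (π : IsPermutation m (a ++ b)) where

    private
      rot : List ℕ
      rot = rotate (suc m) (a , b)

      π-rot : IsPermutation (suc m) rot
      π-rot = IsPermutation-resp-↭ (↭-sym (rotate-↭ (suc m) a b)) (IsPermutation-top∷⁺ π)

      sgn-rot : sgn rot ≡ sgn (a ++ b)
      sgn-rot = sgn-rotate (suc m) a b (IsPermutation⇒< π) (unique π) (trans (cong even (length≡ π)) m-even)

      asc-rot : asc rot + ind (cut (a , b)) ≡ suc (asc (a ++ b))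
      asc-rot = asc-rotate (suc m) a b (IsPermutation⇒< π)
                  (λ ab≡[] → <-irrefl (trans (cong length (sym ab≡[])) (length≡ π)) 0<m)

      last<head : (last0 rot <ᵇ head0 rot) ≡ cut (a , b)
      last<head = cong₂ _<ᵇ_ (last0-rotate (suc m) a b) (head0-rotate (suc m) a b)

      head<last : (head0 rot <ᵇ last0 rot) ≡ not (cut (a , b))
      head<last = trans (<ᵇ-flip (head0≢last0 (unique π-rot) 2≤length)) (cong not last<head)
        where
        2≤length : 2 ≤ length rot
        2≤length = subst (2 ≤_) (sym (length≡ π-rot)) (s≤s 0<m)

    minusTerm-rotate : minusTerm (suc j) rot ≡ when (not (cut (a , b))) (ascTerm j (a ++ b))
    minusTerm-rotate {j} = trans (cong₂ (λ c t → when (asc rot ≡ᵇ suc j) (when c t)) head<last sgn-rot)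
                                 (when-minus (cut (a , b)) asc-rot)

    plusTerm-rotate : plusTerm k rot ≡ when (cut (a , b)) (ascTerm k (a ++ b))
    plusTerm-rotate {k} = trans (cong₂ (λ c t → when (asc rot ≡ᵇ k) (when c t)) last<head sgn-rot)
                                (when-plus (cut (a , b)) asc-rot)

  count-cut : IsPermutation m u → count cut (splits u) ≡ suc (asc u)
  count-cut {[]}    π = ⊥-elim (<-irrefl (length≡ π) 0<m)
  count-cut {_ ∷ _} π = count-ascendingCut-max (IsPermutation⇒< π)

  count-not-cut : IsPermutation m u → count (not ∘ cut) (splits u) ≡ m ∸ asc u
  count-not-cut {u} π = begin
    count (not ∘ cut) (splits u)
      ≡⟨ m+n∸n≡m _ (count cut (splits u)) ⟨
    (count (not ∘ cut) (splits u) + count cut (splits u)) ∸ count cut (splits u)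
      ≡⟨ cong₂ _∸_ (count-not cut (splits u)) (count-cut π) ⟩
    length (splits u) ∸ suc (asc u)
      ≡⟨ cong (_∸ suc (asc u)) (trans (length-splits u) (cong suc (length≡ π))) ⟩
    m ∸ asc u ∎
    where open ≡-Reasoning

  ∑-splits-minusTerm : IsPermutation m u →
                       ∑ (splits u) (minusTerm (suc j) ∘ rotate (suc m)) ≡ + (m ∸ j) * ascTerm j u
  ∑-splits-minusTerm {u} {j} π = begin
    ∑ (splits u) (minusTerm (suc j) ∘ rotate (suc m))
      ≡⟨ ∑-cong (splits u) at-split ⟩
    ∑ (splits u) (λ p → when (not (cut p)) (ascTerm j u))
      ≡⟨ ∑-when (not ∘ cut) (ascTerm j u) (splits u) ⟩
    + count (not ∘ cut) (splits u) * ascTerm j u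
      ≡⟨ cong (λ c → + c * ascTerm j u) (count-not-cut π) ⟩
    + (m ∸ asc u) * ascTerm j u
      ≡⟨ *-when-≡ᵇ (λ i → + (m ∸ i)) (asc u) j (sgn u) ⟩
    + (m ∸ j) * ascTerm j u ∎
    where
    open ≡-Reasoning
    at-split : ∀ {p} → p ∈ splits u →
               minusTerm (suc j) (rotate (suc m) p) ≡ when (not (cut p)) (ascTerm j u)
    at-split {a , b} p∈ with splits-sound u p∈
    ... | refl = minusTerm-rotate a b π

  ∑-splits-plusTerm : IsPermutation m u →
                      ∑ (splits u) (plusTerm k ∘ rotate (suc m)) ≡ + (k + 1) * ascTerm k u
  ∑-splits-plusTerm {u} {k} π = begin
    ∑ (splits u) (plusTerm k ∘ rotate (suc m))
      ≡⟨ ∑-cong (splits u) at-split ⟩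
    ∑ (splits u) (λ p → when (cut p) (ascTerm k u))
      ≡⟨ ∑-when cut (ascTerm k u) (splits u) ⟩
    + count cut (splits u) * ascTerm k u
      ≡⟨ cong (λ c → + c * ascTerm k u) (trans (count-cut π) (+-comm 1 (asc u))) ⟩
    + (asc u + 1) * ascTerm k u
      ≡⟨ *-when-≡ᵇ (λ i → + (i + 1)) (asc u) k (sgn u) ⟩
    + (k + 1) * ascTerm k u ∎
    where
    open ≡-Reasoning
    at-split : ∀ {p} → p ∈ splits u → plusTerm k (rotate (suc m) p) ≡ when (cut p) (ascTerm k u)
    at-split {a , b} p∈ with splits-sound u p∈
    ... | refl = plusTerm-rotate a b π

  Dminus-suc : ∀ j → Dminus (suc m) (suc j) ≡ + (m ∸ j) * D m j
  Dminus-suc j = begin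
    Dminus (suc m) (suc j)
      ≡⟨ Dminus≡∑ (suc m) (suc j) ⟩
    ∑ (perms (suc m)) (minusTerm (suc j))
      ≡⟨ ∑-perms-suc m (minusTerm (suc j)) ⟩
    ∑ (perms m) (λ u → ∑ (splits u) (minusTerm (suc j) ∘ rotate (suc m)))
      ≡⟨ ∑-cong (perms m) (∑-splits-minusTerm ∘ ∈-perms⁻) ⟩
    ∑ (perms m) (λ u → + (m ∸ j) * ascTerm j u)
      ≡⟨ ∑-*ˡ (+ (m ∸ j)) (perms m) (ascTerm j) ⟩
    + (m ∸ j) * ∑ (perms m) (ascTerm j)
      ≡⟨ cong (+ (m ∸ j) *_) (D≡∑ m j) ⟨
    + (m ∸ j) * D m j ∎
    where open ≡-Reasoning

  Dplus-suc : ∀ k → Dplus (suc m) k ≡ + (k + 1) * D m k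
  Dplus-suc k = begin
    Dplus (suc m) k
      ≡⟨ Dplus≡∑ (suc m) k ⟩
    ∑ (perms (suc m)) (plusTerm k)
      ≡⟨ ∑-perms-suc m (plusTerm k) ⟩
    ∑ (perms m) (λ u → ∑ (splits u) (plusTerm k ∘ rotate (suc m)))
      ≡⟨ ∑-cong (perms m) (∑-splits-plusTerm ∘ ∈-perms⁻) ⟩
    ∑ (perms m) (λ u → + (k + 1) * ascTerm k u)
      ≡⟨ ∑-*ˡ (+ (k + 1)) (perms m) (ascTerm k) ⟩
    + (k + 1) * ∑ (perms m) (ascTerm k)
      ≡⟨ cong (+ (k + 1) *_) (D≡∑ m k) ⟨
    + (k + 1) * D m k ∎
    where open ≡-Reasoning

corollary3p4 : (n : ℕ) → 3 ≤ n → (∃[ m ] n ≡ suc (m + m)) →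
    ((k : ℕ) → 1 ≤ k → k ≤ n ∸ 1 → Dminus n k ≡ (+ (n ∸ k)) * D (n ∸ 1) (k ∸ 1))
    × ((k : ℕ) → k ≤ n ∸ 2 → Dplus n k ≡ (+ (k + 1)) * D (n ∸ 1) k)
corollary3p4 _ (s≤s ()) (zero , refl)
corollary3p4 _ _        (suc h , refl) =
  (λ { zero () _ ; (suc j) _ _ → Dminus-suc 0<m even-m j }) , (λ k _ → Dplus-suc 0<m even-m k)
  where
  0<m : 0 < suc h + suc h
  0<m = s≤s z≤n
  even-m : even (suc h + suc h) ≡ true
  even-m = even-double (suc h)
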